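{- Let $\mathcal{I}[n]=\{m\in\mathbb{Z}\mid m\le n\}\cup\{ -\infty,+\infty\}$. For all $n_1,n_2\in\mathbb{Z}$ with $n_1\le n_2$, $\mathrm{TPTL}^{\mathcal{I}[n_2]}$ is at least as expressive as $\mathrm{TPTL}^{\mathcal{I}[n_1]}$, and if $n_1<n_2$ then $\mathrm{TPTL}^{\mathcal{I}[n_2]}$ is strictly more expressive than $\mathrm{TPTL}^{\mathcal{I}[n_1]}$.
   Context: Data words: infinite sequences $(P_0,d_0)(P_1,d_1)\dots$ with $P_i\subseteq\mathcal{P}$ (finite set of propositions) and $d_i\in\mathbb{N}$. Intervals are integer intervals with endpoints in $\mathbb{Z}\cup\{\pm\infty\}$. TPTL: $\varphi::=p\mid x\in I\mid\neg\varphi\mid\varphi_1\wedge\varphi_2\mid\varphi_1\mathsf{U}\varphi_2\mid x.\varphi$; $(w,i,\nu)\models p$ iff $p\in P_i$; $(w,i,\nu)\models x\in I$ iff $d_i-\nu(x)\in I$; $(w,i,\nu)\models x.\varphi$ iff $(w,i,\nu[x\mapsto d_i])\models\varphi$; $(w,i,\nu)\models\varphi_1\mathsf{U}\varphi_2$ iff there is $j>i$ with $(w,j,\nu)\models\varphi_2$ and $(w,k,\nu)\models\varphi_1$ for all $i<k<j$; $w\models\varphi$ iff $(w,0,\nu_0)\models\varphi$ with $\nu_0$ mapping all registers to $d_0$. For $\mathcal{I}=S\cup\{\pm\infty\}$, $S\subseteq\mathbb{Z}$, $\mathrm{TPTL}^{\mathcal{I}}$ is the set of TPTL formulas in which every subformula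 $x\in I$ has both endpoints of $I$ in $\mathcal{I}$. At least as expressive: every formula of the smaller logic has an equivalent (same satisfying data words) in the larger; strictly: additionally not conversely. -}

module Defs where

open import Data.Nat using (ℕ; _<_; _≟_)
open import Data.Integer as ℤ using (ℤ; +_; _-_)
open import Data.Bool using (Bool; true; false)
open import Data.Fin using (Fin)
open import Data.Fin.Subset using (Subset; _∈_)
open import Data.Product using (_×_; _,_; proj₁; proj₂; Σ; ∃)
open import Data.Sum using (_⊎_)
open import Data.Empty using (⊥)
open import Data.Unit using (⊤)
open import Relation.Nullary using (¬_; yes; no)
open import Function.Bundles using (_⇔_)

data ℤ∞ : Set where
  -∞  : ℤ∞
  fin : ℤ → ℤ∞
  +∞  : ℤ∞

-- Infinite endpoints are never attained by an integer, so the flag is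
-- irrelevant for them.
record Interval : Set where
  constructor interval
  field
    lo       : ℤ∞
    loClosed : Bool
    hi       : ℤ∞
    hiClosed : Bool

AboveLo : ℤ∞ → Bool → ℤ → Set
AboveLo -∞      _     d = ⊤
AboveLo (fin a) true  d = a ℤ.≤ d
AboveLo (fin a) false d = a ℤ.< d
AboveLo +∞      _     d = ⊥

BelowHi : ℤ∞ → Bool → ℤ → Set
BelowHi -∞      _     d = ⊥
BelowHi (fin b) true  d = d ℤ.≤ b
BelowHi (fin b) false d = d ℤ.< b
BelowHi +∞      _     d = ⊤

_∈I_ : ℤ → Interval → Set
d ∈I (interval a ca b cb) = AboveLo a ca d × BelowHi b cb d

Reg : Set
Reg = ℕ

data TPTL (k : ℕ) : Set where
  prop  : Fin k → TPTL k
  _∈ᶜ_  : Reg → Interval → TPTL k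
  ¬'_   : TPTL k → TPTL k
  _∧'_  : TPTL k → TPTL k → TPTL k
  _U_   : TPTL k → TPTL k → TPTL k
  frz   : Reg → TPTL k → TPTL k

DataWord : ℕ → Set
DataWord k = ℕ → Subset k × ℕ

Valuation : Set
Valuation = Reg → ℕ

update : Valuation → Reg → ℕ → Valuation
update ν x d y with x ≟ y
... | yes _ = d
... | no  _ = ν y

-- Satisfaction relation (w , i , ν) ⊨ φ  (strict until, as in the paper)
Sat : ∀ {k} → DataWord k → ℕ → Valuation → TPTL k → Set
Sat w i ν (prop p)   = p ∈ proj₁ (w i)
Sat w i ν (x ∈ᶜ I)   = ((+ proj₂ (w i)) - (+ ν x)) ∈I I
Sat w i ν (¬' φ)     = ¬ Sat w i ν φ
Sat w i ν (φ ∧' ψ)   = Sat w i ν φ × Sat w i ν ψ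
Sat w i ν (φ U ψ)    = Σ ℕ λ j → i < j × Sat w j ν ψ
                         × (∀ l → i < l → l < j → Sat w l ν φ)
Sat w i ν (frz x φ)  = Sat w i (update ν x (proj₂ (w i))) φ

Models : ∀ {k} → DataWord k → TPTL k → Set
Models w φ = Sat w 0 (λ _ → proj₂ (w 0)) φ

InEnds : (ℤ → Set) → ℤ∞ → Set
InEnds S -∞      = ⊤
InEnds S (fin z) = S z
InEnds S +∞      = ⊤

InFrag : ∀ {k} → (ℤ → Set) → TPTL k → Set
InFrag S (prop p)  = ⊤
InFrag S (x ∈ᶜ I)  = InEnds S (Interval.lo I) × InEnds S (Interval.hi I)
InFrag S (¬' φ)    = InFrag S φ
InFrag S (φ ∧' ψ)  = InFrag S φ × InFrag S ψ
InFrag S (φ U ψ)   = InFrag S φ × InFrag S ψ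
InFrag S (frz x φ) = InFrag S φ

Equivalent : ∀ {k} → TPTL k → TPTL k → Set
Equivalent {k} φ ψ = ∀ (w : DataWord k) → Models w φ ⇔ Models w ψ

AtLeastAsExpressive : ℕ → (ℤ → Set) → (ℤ → Set) → Set
AtLeastAsExpressive k S₂ S₁ =
  ∀ (φ : TPTL k) → InFrag S₁ φ → Σ (TPTL k) λ ψ → InFrag S₂ ψ × Equivalent φ ψ

StrictlyMoreExpressive : ℕ → (ℤ → Set) → (ℤ → Set) → Set
StrictlyMoreExpressive k S₂ S₁ =
  AtLeastAsExpressive k S₂ S₁ × ¬ AtLeastAsExpressive k S₁ S₂

Upto : ℤ → ℤ → Set
Upto n m = m ℤ.≤ n

-- Enlarging the set of endpoints only admits more formulas, which gives the first claim.
-- For strictness, let n₁ < n₂ and write n₂ = b − a with a, b ∈ ℕ. The data words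
-- a b b b … and a (b+1) (b+1) … are told apart by the TPTL^{𝓘[n₂]} formula
-- ⊤ U (x ∈ [n₂, n₂]), but no TPTL^{𝓘[n₁]} formula distinguishes them: every register
-- holds either a in both words, or (from position 1 on) b in the first and b+1 in the
-- second. Clock differences are then either equal in the two words or both exceed n₁,
-- and no interval with endpoints in 𝓘[n₁] separates two integers above n₁.
module Submission where

open import Defs
open import Data.Nat as ℕ using (ℕ; zero; suc; z<s)
open import Data.Nat.Properties using (n<1+n)
open import Data.Integer as ℤ using (ℤ; _≤_; _<_; +_; -[1+_]; _-_; +<+)
open import Data.Integer.Properties as ℤ using (≤-refl; ≤-trans; ≤-<-trans; <⇒≤; <⇒≱)
open import Data.Product using (_×_; _,_; ∃₂)
open import Data.Sum using (_⊎_; inj₁; inj₂)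
open import Data.Empty using (⊥-elim)
open import Data.Unit using (tt)
open import Data.Bool using (true; false)
open import Data.Fin.Subset as Subset using ()
open import Function.Bundles using (mk⇔; Equivalence)
open import Relation.Nullary using (¬_; yes; no)
open import Relation.Binary.PropositionalEquality using (_≡_; refl; sym; trans; subst)

InEnds-mono : ∀ {S T : ℤ → Set} → (∀ {z} → S z → T z) → ∀ e → InEnds S e → InEnds T e
InEnds-mono S⊆T -∞      _  = tt
InEnds-mono S⊆T (fin z) Sz = S⊆T Sz
InEnds-mono S⊆T +∞      _  = tt

InFrag-mono : ∀ {k} {S T : ℤ → Set} → (∀ {z} → S z → T z) → (φ : TPTL k) → InFrag S φ → InFrag T φ
InFrag-mono S⊆T (prop p) _ = tt
InFrag-mono S⊆T (x ∈ᶜ interval a _ b _) (ha , hb) = InEnds-mono S⊆T a ha , InEnds-mono S⊆T b hb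
InFrag-mono S⊆T (¬' φ) h = InFrag-mono S⊆T φ h
InFrag-mono S⊆T (φ ∧' ψ) (hφ , hψ) = InFrag-mono S⊆T φ hφ , InFrag-mono S⊆T ψ hψ
InFrag-mono S⊆T (φ U ψ) (hφ , hψ) = InFrag-mono S⊆T φ hφ , InFrag-mono S⊆T ψ hψ
InFrag-mono S⊆T (frz x φ) h = InFrag-mono S⊆T φ h

atLeastAsExpressive-mono : ∀ k {n₁ n₂} → n₁ ≤ n₂ → AtLeastAsExpressive k (Upto n₂) (Upto n₁)
atLeastAsExpressive-mono k n₁≤n₂ φ hφ =
  φ , InFrag-mono (λ z≤n₁ → ≤-trans z≤n₁ n₁≤n₂) φ hφ , λ _ → mk⇔ (λ p → p) (λ p → p)

module _ {n δ δ′ : ℤ} (n<δ : n < δ) (n<δ′ : n < δ′) where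

  AboveLo-beyond : ∀ e c → InEnds (Upto n) e → AboveLo e c δ → AboveLo e c δ′
  AboveLo-beyond -∞      _     _   _  = tt
  AboveLo-beyond (fin e) true  e≤n _  = <⇒≤ (≤-<-trans e≤n n<δ′)
  AboveLo-beyond (fin e) false e≤n _  = ≤-<-trans e≤n n<δ′
  AboveLo-beyond +∞      _     _   ()

  BelowHi-beyond : ∀ e c → InEnds (Upto n) e → BelowHi e c δ → BelowHi e c δ′
  BelowHi-beyond -∞      _     _   ()
  BelowHi-beyond (fin e) true  e≤n δ≤e = ⊥-elim (<⇒≱ n<δ (≤-trans δ≤e e≤n))
  BelowHi-beyond (fin e) false e≤n δ<e = ⊥-elim (<⇒≱ n<δ (≤-trans (<⇒≤ δ<e) e≤n))
  BelowHi-beyond +∞      _     _   _   = tt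

  ∈I-beyond : ∀ {lo cl hi ch} → InEnds (Upto n) lo → InEnds (Upto n) hi →
    δ ∈I interval lo cl hi ch → δ′ ∈I interval lo cl hi ch
  ∈I-beyond {lo} {cl} {hi} {ch} hl hh (δ≥lo , δ≤hi) =
    AboveLo-beyond lo cl hl δ≥lo , BelowHi-beyond hi ch hh δ≤hi

module TwoStepWords (k : ℕ) (n : ℤ) (a : ℕ) where

  datum : ℕ → ℕ → ℕ
  datum b zero    = a
  datum b (suc _) = b

  word : ℕ → DataWord k
  word b i = Subset.⊥ , datum b i

  Far : ℕ → Set
  Far b = n < + b - + a

  RelatedValue : ℕ → ℕ → ℕ → ℕ → ℕ → Set
  RelatedValue i b b′ v v′ = (v ≡ a × v′ ≡ a) ⊎ (0 ℕ.< i × v ≡ b × v′ ≡ b′)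

  Related : ℕ → ℕ → ℕ → Valuation → Valuation → Set
  Related i b b′ ν ν′ = ∀ x → RelatedValue i b b′ (ν x) (ν′ x)

  Related-sym : ∀ {i b b′ ν ν′} → Related i b b′ ν ν′ → Related i b′ b ν′ ν
  Related-sym r x with r x
  ... | inj₁ (νa , ν′a)        = inj₁ (ν′a , νa)
  ... | inj₂ (i>0 , νb , ν′b′) = inj₂ (i>0 , ν′b′ , νb)

  Related-later : ∀ {i j b b′ ν ν′} → i ℕ.< j → Related i b b′ ν ν′ → Related j b b′ ν ν′
  Related-later {j = suc _} _ r x with r x
  ... | inj₁ same            = inj₁ same
  ... | inj₂ (_ , νb , ν′b′) = inj₂ (z<s , νb , ν′b′)

  Related-update : ∀ {i b b′ ν ν′} x → Related i b b′ ν ν′ →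
    Related i b b′ (update ν x (datum b i)) (update ν′ x (datum b′ i))
  Related-update x r y with x ℕ.≟ y
  Related-update {zero}  x r y | yes _ = inj₁ (refl , refl)
  Related-update {suc _} x r y | yes _ = inj₂ (z<s , refl , refl)
  ... | no _ = r y

  m-m≡0 : ∀ m → + m - + m ≡ + 0
  m-m≡0 m = ℤ.+-inverseʳ (+ m)

  clock-transfer : ∀ {i b b′ v v′ lo cl hi ch} → Far b → Far b′ → RelatedValue i b b′ v v′ →
    InEnds (Upto n) lo → InEnds (Upto n) hi →
    (+ datum b i - + v) ∈I interval lo cl hi ch → (+ datum b′ i - + v′) ∈I interval lo cl hi ch
  clock-transfer {zero}  _   _    (inj₁ (refl , refl)) _  _  = λ p → p
  clock-transfer {suc _} far far′ (inj₁ (refl , refl)) hl hh = ∈I-beyond far far′ hl hh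
  clock-transfer {suc _} {b} {b′} _ _ (inj₂ (_ , refl , refl)) _ _ =
    subst (_∈I _) (trans (m-m≡0 b) (sym (m-m≡0 b′)))

  Sat-transfer : ∀ φ → InFrag (Upto n) φ → ∀ {i b b′ ν ν′} → Far b → Far b′ →
    Related i b b′ ν ν′ → Sat (word b) i ν φ → Sat (word b′) i ν′ φ
  Sat-transfer (prop p) _ _ _ _ p∈P = p∈P
  Sat-transfer (x ∈ᶜ interval _ _ _ _) (hl , hh) far far′ r = clock-transfer far far′ (r x) hl hh
  Sat-transfer (¬' φ) h far far′ r ¬sat sat′ =
    ¬sat (Sat-transfer φ h far′ far (Related-sym r) sat′)
  Sat-transfer (φ ∧' ψ) (hφ , hψ) far far′ r (sφ , sψ) =
    Sat-transfer φ hφ far far′ r sφ , Sat-transfer ψ hψ far far′ r sψ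
  Sat-transfer (φ U ψ) (hφ , hψ) far far′ r (j , i<j , sψ , sφ) =
    j , i<j , Sat-transfer ψ hψ far far′ (Related-later i<j r) sψ ,
    λ l i<l l<j → Sat-transfer φ hφ far far′ (Related-later i<l r) (sφ l i<l l<j)
  Sat-transfer (frz x φ) h far far′ r = Sat-transfer φ h far far′ (Related-update x r)

  Models-transfer : ∀ φ → InFrag (Upto n) φ → ∀ {b b′} → Far b → Far b′ →
    Models (word b) φ → Models (word b′) φ
  Models-transfer φ h far far′ = Sat-transfer φ h far far′ (λ _ → inj₁ (refl , refl))

  jumpsBy : ℤ → TPTL k
  jumpsBy d = (0 ∈ᶜ interval -∞ false +∞ false) U (0 ∈ᶜ interval (fin d) true (fin d) true)

  Models-jumpsBy : ∀ b → Models (word b) (jumpsBy (+ b - + a))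
  Models-jumpsBy b = 1 , z<s , (≤-refl , ≤-refl) , λ { (suc l) _ (ℕ.s≤s ()) }

  ¬Models-jumpsBy : ∀ {b b′} → + b - + a < + b′ - + a → ¬ Models (word b′) (jumpsBy (+ b - + a))
  ¬Models-jumpsBy d<d′ (suc j , _ , (_ , d′≤d) , _) = <⇒≱ d<d′ d′≤d

difference-surjective : ∀ z → ∃₂ λ a b → + b - + a ≡ z
difference-surjective (+ m)    = 0 , m , ℤ.+-identityʳ (+ m)
difference-surjective -[1+ m ] = suc m , 0 , refl

¬atLeastAsExpressive-smaller : ∀ k {n₁ n₂} → n₁ < n₂ → ¬ AtLeastAsExpressive k (Upto n₁) (Upto n₂)
¬atLeastAsExpressive-smaller k {n₁} {n₂} n₁<n₂ translate with difference-surjective n₂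
... | a , b , refl with translate (jumpsBy (+ b - + a)) ((tt , tt) , (≤-refl , ≤-refl))
  where open TwoStepWords k n₁ a
... | ψ , ψ∈frag , φ⇔ψ =
  ¬Models-jumpsBy d<d′ (Equivalence.from (φ⇔ψ (word (suc b)))
    (Models-transfer ψ ψ∈frag n₁<n₂ (ℤ.<-trans n₁<n₂ d<d′)
      (Equivalence.to (φ⇔ψ (word b)) (Models-jumpsBy b))))
  where
  open TwoStepWords k n₁ a
  d<d′ : + b - + a < + suc b - + a
  d<d′ = ℤ.+-monoˡ-< (ℤ.- + a) (+<+ (n<1+n b))

proposition9 : (k : ℕ) (n₁ n₂ : ℤ) → n₁ ≤ n₂ →
    AtLeastAsExpressive k (Upto n₂) (Upto n₁)
    × (n₁ < n₂ → StrictlyMoreExpressive k (Upto n₂) (Upto n₁))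
proposition9 k n₁ n₂ n₁≤n₂ =
  atLeastAsExpressive-mono k n₁≤n₂ ,
  λ n₁<n₂ → atLeastAsExpressive-mono k n₁≤n₂ , ¬atLeastAsExpressive-smaller k n₁<n₂
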